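{- For every $\mathcal{L}$-formula $\alpha$: if $\textbf{Int}^{\square}\vdash\alpha$, then $\textbf{Int}^{\square}\Vdash\alpha$, i.e. there is a refined derivation $D$ of $\alpha$ in $\textbf{Int}^{\square}$ with $M(D)\subseteq M(\langle\alpha\rangle)$.
   Context: The language $\mathcal{L}$ has propositional variables $p_0,p_1,\ldots$, connectives $\wedge,\vee,\rightarrow,\neg$ and a unary modality $\square$. A substitution is an endomorphism of the algebra of $\mathcal{L}$-formulas. Let $(\mathrm{Ax}_0)$ be a standard finite list of axioms of the intuitionistic propositional calculus written as particular $\square$-free formulas. A derivation is a finite sequence of formulas each of which is an axiom, or obtained from an earlier formula by substitution, or from earlier $\varphi$ and $\varphi\rightarrow\psi$ by modus ponens. $\textbf{Int}^{\square}\vdash\beta$ means $\beta$ is derivable with axioms $(\mathrm{Ax}_0)$ only and substitution of arbitrary $\mathcal{L}$-formulas. A derivation is refined if every application of substitution is applied only to an axiom occurring in the derivation (or to the premise, if there is one). A $\square$-formula is a formula of the form $\square\gamma$. For a nonempty finite list $S$ of formulas, a $\square$-formula $\square\gamma$ is a maximal subformula of $S$ if it is a subformula of at least one member of $S$ and, in each member of $S$ in which it occurs, it does not occur within the scope of $\square$ (i.e. it is not a proper subformula of any $\square$-subformula there). $M(S)$ denotes the set of maximal subformulas of $S$; a derivation is regarded as a list of formulas. $\textbf{Int}^{\square}\Vdash\alpha$ means there is a refined derivation $D$ of $\alpha$ in $\textbf{Int}^{\square}$ with $M(D)\subseteq M(\langle\alpha\rangle)$ (a pure derivation). -}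

module Defs where

open import Data.Nat using (ℕ)
open import Data.Fin using (Fin; _<_; zero; suc)
open import Data.List using (List; []; _∷_; length; lookup; last)
open import Data.List.Membership.Propositional using (_∈_)
open import Data.Maybe using (just)
open import Data.Product using (Σ; ∃; _×_)
open import Data.Unit using (⊤)
open import Relation.Nullary using (¬_)
open import Relation.Binary.PropositionalEquality using (_≡_)

infixr 6 _∧'_
infixr 5 _∨'_
infixr 4 _⇒_

data Formula : Set where
  var  : ℕ → Formula
  _∧'_ : Formula → Formula → Formula
  _∨'_ : Formula → Formula → Formula
  _⇒_  : Formula → Formula → Formula
  ¬'_  : Formula → Formula
  □_   : Formula → Formula

Subst : Set
Subst = ℕ → Formula

_⟦_⟧ : Formula → Subst → Formula
var n    ⟦ σ ⟧ = σ n
(a ∧' b) ⟦ σ ⟧ = (a ⟦ σ ⟧) ∧' (b ⟦ σ ⟧)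
(a ∨' b) ⟦ σ ⟧ = (a ⟦ σ ⟧) ∨' (b ⟦ σ ⟧)
(a ⇒ b)  ⟦ σ ⟧ = (a ⟦ σ ⟧) ⇒ (b ⟦ σ ⟧)
(¬' a)   ⟦ σ ⟧ = ¬' (a ⟦ σ ⟧)
(□ a)    ⟦ σ ⟧ = □ (a ⟦ σ ⟧)

p₀ p₁ p₂ : Formula
p₀ = var 0
p₁ = var 1
p₂ = var 2

-- (Ax₀): a standard (Kleene-style) finite list of axioms of intuitionistic
-- propositional calculus, written as □-free formulas.
Ax₀ : List Formula
Ax₀ =
    (p₀ ⇒ (p₁ ⇒ p₀))
  ∷ ((p₀ ⇒ (p₁ ⇒ p₂)) ⇒ ((p₀ ⇒ p₁) ⇒ (p₀ ⇒ p₂)))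
  ∷ ((p₀ ∧' p₁) ⇒ p₀)
  ∷ ((p₀ ∧' p₁) ⇒ p₁)
  ∷ (p₀ ⇒ (p₁ ⇒ (p₀ ∧' p₁)))
  ∷ (p₀ ⇒ (p₀ ∨' p₁))
  ∷ (p₁ ⇒ (p₀ ∨' p₁))
  ∷ ((p₀ ⇒ p₂) ⇒ ((p₁ ⇒ p₂) ⇒ ((p₀ ∨' p₁) ⇒ p₂)))
  ∷ ((p₀ ⇒ p₁) ⇒ ((p₀ ⇒ ¬' p₁) ⇒ ¬' p₀))
  ∷ (¬' p₀ ⇒ (p₀ ⇒ p₁))
  ∷ []

-- The parameter
-- `Src` restricts which formulas substitution may be applied to:
-- Src = λ _ → ⊤ gives arbitrary derivations, Src = (_∈ Ax₀) refined ones.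
data Step (Src : Formula → Set) (D : List Formula) (i : Fin (length D)) : Set where
  axiom : lookup D i ∈ Ax₀ → Step Src D i
  subst : (j : Fin (length D)) → j < i → Src (lookup D j) →
          (σ : Subst) → lookup D i ≡ (lookup D j ⟦ σ ⟧) → Step Src D i
  mp    : (j k : Fin (length D)) → j < i → k < i →
          lookup D k ≡ (lookup D j ⇒ lookup D i) → Step Src D i

DerivationOf : (Formula → Set) → List Formula → Formula → Set
DerivationOf Src D α = ((i : Fin (length D)) → Step Src D i) × (last D ≡ just α)

AnySource : Formula → Set
AnySource _ = ⊤

AxiomSource : Formula → Set
AxiomSource φ = φ ∈ Ax₀

Int□⊢_ : Formula → Set
Int□⊢ β = ∃ λ D → DerivationOf AnySource D β

RefinedDerivationOf : List Formula → Formula → Set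
RefinedDerivationOf = DerivationOf AxiomSource

data _≼_ : Formula → Formula → Set where
  here  : ∀ {a} → a ≼ a
  ∧l    : ∀ {a b c} → a ≼ b → a ≼ (b ∧' c)
  ∧r    : ∀ {a b c} → a ≼ c → a ≼ (b ∧' c)
  ∨l    : ∀ {a b c} → a ≼ b → a ≼ (b ∨' c)
  ∨r    : ∀ {a b c} → a ≼ c → a ≼ (b ∨' c)
  ⇒l    : ∀ {a b c} → a ≼ b → a ≼ (b ⇒ c)
  ⇒r    : ∀ {a b c} → a ≼ c → a ≼ (b ⇒ c)
  ¬s    : ∀ {a b} → a ≼ b → a ≼ (¬' b)
  □s    : ∀ {a b} → a ≼ b → a ≼ (□ b)

-- ψ occurs in φ within the scope of □: ψ is a proper subformula of some
-- □-subformula □δ of φ (proper subformulas of □δ = subformulas of δ).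
InScopeOf□ : Formula → Formula → Set
InScopeOf□ ψ φ = ∃ λ δ → ((□ δ) ≼ φ) × (ψ ≼ δ)

_∈M_ : Formula → List Formula → Set
ψ ∈M S = (∃ λ γ → ψ ≡ □ γ)
       × (∃ λ φ → (φ ∈ S) × (ψ ≼ φ))
       × (∀ φ → φ ∈ S → ψ ≼ φ → ¬ InScopeOf□ ψ φ)

_⊆M_ : List Formula → List Formula → Set
S ⊆M T = ∀ ψ → ψ ∈M S → ψ ∈M T

Int□⊩_ : Formula → Set
Int□⊩ α = ∃ λ D → RefinedDerivationOf D α × (D ⊆M (α ∷ []))

-- Push every substitution of a derivation of α up to the axioms, obtaining a
-- tree whose leaves are axiom instances.  Then replace each □-formula that is
-- not a subformula of α by p₀.  This map commutes with substitution into the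
-- □-free axioms and with the connectives, so the tree remains a derivation; it
-- fixes α; and afterwards every □-formula occurring outside the scope of □
-- is a subformula of α.  Writing the tree out line by line gives a refined
-- derivation containing α, whose maximal subformulas are therefore maximal
-- subformulas of α.
module Submission where

open import Defs
open import Data.Empty using (⊥; ⊥-elim)
open import Data.Fin as Fin using (Fin; zero; suc; toℕ)
open import Data.Fin.Induction using (<-wellFounded)
open import Data.Fin.Properties using (toℕ<n)
open import Data.List using (List; []; _∷_; _∷ʳ_; length; lookup; last)
open import Data.List.Membership.Propositional using (_∈_)
open import Data.List.Relation.Binary.Subset.Propositional using (_⊆_)
open import Data.List.Relation.Binary.Subset.Propositional.Properties using (⊆-trans; xs⊆xs++ys)
open import Data.List.Relation.Unary.All as All using (All; []; _∷_)
open import Data.List.Relation.Unary.All.Properties using (∷ʳ⁺)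
open import Data.List.Relation.Unary.Any as Any using (here; there)
open import Data.List.Relation.Unary.Any.Properties using (lookup-index)
open import Data.Maybe using (just)
import Data.Nat as ℕ
open import Data.Product using (∃-syntax; _×_; _,_; uncurry)
open import Data.Sum using (inj₁; inj₂; [_,_])
open import Data.Unit using (⊤)
open import Function using (_∘_; id)
open import Induction.WellFounded using (Acc; acc)
open import Relation.Binary.Definitions using (DecidableEquality; Decidable)
open import Relation.Binary.PropositionalEquality
  using (_≡_; refl; sym; trans; cong; cong₂)
import Relation.Binary.PropositionalEquality as ≡
open import Relation.Nullary using (¬_; yes; no)
open import Relation.Nullary.Decidable using (map′; _×-dec_; _⊎-dec_)
open import Relation.Unary using (U)

infix 3 _≟_ _≼?_

_≟_ : DecidableEquality Formula
var m    ≟ var n    = map′ (cong var) (λ { refl → refl }) (m ℕ.≟ n)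
(a ∧' b) ≟ (c ∧' d) = map′ (uncurry (cong₂ _∧'_)) (λ { refl → refl , refl }) (a ≟ c ×-dec b ≟ d)
(a ∨' b) ≟ (c ∨' d) = map′ (uncurry (cong₂ _∨'_)) (λ { refl → refl , refl }) (a ≟ c ×-dec b ≟ d)
(a ⇒ b)  ≟ (c ⇒ d)  = map′ (uncurry (cong₂ _⇒_)) (λ { refl → refl , refl }) (a ≟ c ×-dec b ≟ d)
(¬' a)   ≟ (¬' c)   = map′ (cong ¬'_) (λ { refl → refl }) (a ≟ c)
(□ a)    ≟ (□ c)    = map′ (cong □_) (λ { refl → refl }) (a ≟ c)
var _    ≟ (_ ∧' _) = no λ ()
var _    ≟ (_ ∨' _) = no λ ()
var _    ≟ (_ ⇒ _)  = no λ ()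
var _    ≟ (¬' _)   = no λ ()
var _    ≟ (□ _)    = no λ ()
(_ ∧' _) ≟ var _    = no λ ()
(_ ∧' _) ≟ (_ ∨' _) = no λ ()
(_ ∧' _) ≟ (_ ⇒ _)  = no λ ()
(_ ∧' _) ≟ (¬' _)   = no λ ()
(_ ∧' _) ≟ (□ _)    = no λ ()
(_ ∨' _) ≟ var _    = no λ ()
(_ ∨' _) ≟ (_ ∧' _) = no λ ()
(_ ∨' _) ≟ (_ ⇒ _)  = no λ ()
(_ ∨' _) ≟ (¬' _)   = no λ ()
(_ ∨' _) ≟ (□ _)    = no λ ()
(_ ⇒ _)  ≟ var _    = no λ ()
(_ ⇒ _)  ≟ (_ ∧' _) = no λ ()
(_ ⇒ _)  ≟ (_ ∨' _) = no λ ()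
(_ ⇒ _)  ≟ (¬' _)   = no λ ()
(_ ⇒ _)  ≟ (□ _)    = no λ ()
(¬' _)   ≟ var _    = no λ ()
(¬' _)   ≟ (_ ∧' _) = no λ ()
(¬' _)   ≟ (_ ∨' _) = no λ ()
(¬' _)   ≟ (_ ⇒ _)  = no λ ()
(¬' _)   ≟ (□ _)    = no λ ()
(□ _)    ≟ var _    = no λ ()
(□ _)    ≟ (_ ∧' _) = no λ ()
(□ _)    ≟ (_ ∨' _) = no λ ()
(□ _)    ≟ (_ ⇒ _)  = no λ ()
(□ _)    ≟ (¬' _)   = no λ ()

_≼?_ : Decidable _≼_
a ≼? var n =
  map′ (λ { refl → here }) (λ { here → refl }) (a ≟ var n)
a ≼? b ∧' c =
  map′ [ (λ { refl → here }) , [ ∧l , ∧r ] ]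
       (λ { here → inj₁ refl ; (∧l p) → inj₂ (inj₁ p) ; (∧r p) → inj₂ (inj₂ p) })
       (a ≟ b ∧' c ⊎-dec a ≼? b ⊎-dec a ≼? c)
a ≼? b ∨' c =
  map′ [ (λ { refl → here }) , [ ∨l , ∨r ] ]
       (λ { here → inj₁ refl ; (∨l p) → inj₂ (inj₁ p) ; (∨r p) → inj₂ (inj₂ p) })
       (a ≟ b ∨' c ⊎-dec a ≼? b ⊎-dec a ≼? c)
a ≼? b ⇒ c =
  map′ [ (λ { refl → here }) , [ ⇒l , ⇒r ] ]
       (λ { here → inj₁ refl ; (⇒l p) → inj₂ (inj₁ p) ; (⇒r p) → inj₂ (inj₂ p) })
       (a ≟ b ⇒ c ⊎-dec a ≼? b ⊎-dec a ≼? c)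
a ≼? ¬' b =
  map′ [ (λ { refl → here }) , ¬s ]
       (λ { here → inj₁ refl ; (¬s p) → inj₂ p })
       (a ≟ ¬' b ⊎-dec a ≼? b)
a ≼? □ b =
  map′ [ (λ { refl → here }) , □s ]
       (λ { here → inj₁ refl ; (□s p) → inj₂ p })
       (a ≟ □ b ⊎-dec a ≼? b)

≼-trans : ∀ {a b c} → a ≼ b → b ≼ c → a ≼ c
≼-trans p here   = p
≼-trans p (∧l q) = ∧l (≼-trans p q)
≼-trans p (∧r q) = ∧r (≼-trans p q)
≼-trans p (∨l q) = ∨l (≼-trans p q)
≼-trans p (∨r q) = ∨r (≼-trans p q)
≼-trans p (⇒l q) = ⇒l (≼-trans p q)
≼-trans p (⇒r q) = ⇒r (≼-trans p q)
≼-trans p (¬s q) = ¬s (≼-trans p q)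
≼-trans p (□s q) = □s (≼-trans p q)

InScopeOf□-≼ : ∀ {ψ φ φ′} → φ ≼ φ′ → InScopeOf□ ψ φ → InScopeOf□ ψ φ′
InScopeOf□-≼ φ≼φ′ (δ , □δ≼φ , ψ≼δ) = δ , ≼-trans □δ≼φ φ≼φ′ , ψ≼δ

BoxFree : Formula → Set
BoxFree (var _)  = ⊤
BoxFree (a ∧' b) = BoxFree a × BoxFree b
BoxFree (a ∨' b) = BoxFree a × BoxFree b
BoxFree (a ⇒ b)  = BoxFree a × BoxFree b
BoxFree (¬' a)   = BoxFree a
BoxFree (□ _)    = ⊥

boxFree⇒□⋠ : ∀ {φ γ} → BoxFree φ → ¬ ((□ γ) ≼ φ)
boxFree⇒□⋠ {a ∧' b} (fa , fb) (∧l p) = boxFree⇒□⋠ fa p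
boxFree⇒□⋠ {a ∧' b} (fa , fb) (∧r p) = boxFree⇒□⋠ fb p
boxFree⇒□⋠ {a ∨' b} (fa , fb) (∨l p) = boxFree⇒□⋠ fa p
boxFree⇒□⋠ {a ∨' b} (fa , fb) (∨r p) = boxFree⇒□⋠ fb p
boxFree⇒□⋠ {a ⇒ b}  (fa , fb) (⇒l p) = boxFree⇒□⋠ fa p
boxFree⇒□⋠ {a ⇒ b}  (fa , fb) (⇒r p) = boxFree⇒□⋠ fb p
boxFree⇒□⋠ {¬' a}   fa        (¬s p) = boxFree⇒□⋠ fa p

Ax₀-boxFree : All BoxFree Ax₀
Ax₀-boxFree = _ ∷ _ ∷ _ ∷ _ ∷ _ ∷ _ ∷ _ ∷ _ ∷ _ ∷ _ ∷ []

⟦⟧-var : ∀ φ → φ ⟦ var ⟧ ≡ φ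
⟦⟧-var (var n)  = refl
⟦⟧-var (a ∧' b) = cong₂ _∧'_ (⟦⟧-var a) (⟦⟧-var b)
⟦⟧-var (a ∨' b) = cong₂ _∨'_ (⟦⟧-var a) (⟦⟧-var b)
⟦⟧-var (a ⇒ b)  = cong₂ _⇒_ (⟦⟧-var a) (⟦⟧-var b)
⟦⟧-var (¬' a)   = cong ¬'_ (⟦⟧-var a)
⟦⟧-var (□ a)    = cong □_ (⟦⟧-var a)

⟦⟧-⟦⟧ : ∀ φ σ τ → φ ⟦ σ ⟧ ⟦ τ ⟧ ≡ φ ⟦ _⟦ τ ⟧ ∘ σ ⟧
⟦⟧-⟦⟧ (var n)  σ τ = refl
⟦⟧-⟦⟧ (a ∧' b) σ τ = cong₂ _∧'_ (⟦⟧-⟦⟧ a σ τ) (⟦⟧-⟦⟧ b σ τ)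
⟦⟧-⟦⟧ (a ∨' b) σ τ = cong₂ _∨'_ (⟦⟧-⟦⟧ a σ τ) (⟦⟧-⟦⟧ b σ τ)
⟦⟧-⟦⟧ (a ⇒ b)  σ τ = cong₂ _⇒_ (⟦⟧-⟦⟧ a σ τ) (⟦⟧-⟦⟧ b σ τ)
⟦⟧-⟦⟧ (¬' a)   σ τ = cong ¬'_ (⟦⟧-⟦⟧ a σ τ)
⟦⟧-⟦⟧ (□ a)    σ τ = cong □_ (⟦⟧-⟦⟧ a σ τ)

data Tree (P : Formula → Set) : Formula → Set where
  inst : ∀ {φ} → φ ∈ Ax₀ → P φ → (σ : Subst) → P (φ ⟦ σ ⟧) → Tree P (φ ⟦ σ ⟧)
  mp   : ∀ {a b} → Tree P a → Tree P (a ⇒ b) → P b → Tree P b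

module _ {D : List Formula} (steps : (i : Fin (length D)) → Step AnySource D i) where

  instance-tree : (i : Fin (length D)) → Acc Fin._<_ i → (τ : Subst) →
                  Tree U (lookup D i ⟦ τ ⟧)
  instance-tree i (acc earlier) τ with steps i
  ... | axiom m = inst m _ τ _
  ... | subst j j<i _ σ eq rewrite eq | ⟦⟧-⟦⟧ (lookup D j) σ τ =
    instance-tree j (earlier j<i) (_⟦ τ ⟧ ∘ σ)
  ... | mp j k j<i k<i eq =
    mp (instance-tree j (earlier j<i) τ)
       (≡.subst (Tree U) (cong (_⟦ τ ⟧) eq) (instance-tree k (earlier k<i) τ)) _

last∈ : ∀ (D : List Formula) {φ} → last D ≡ just φ → φ ∈ D
last∈ (_ ∷ [])     refl = here refl
last∈ (_ ∷ _ ∷ D)  eq   = there (last∈ (_ ∷ D) eq)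

derivation⇒tree : ∀ {D α} → DerivationOf AnySource D α → Tree U α
derivation⇒tree {D} {α} (steps , ends) =
  ≡.subst (Tree U) (trans (⟦⟧-var _) (sym (lookup-index α∈D)))
          (instance-tree steps (Any.index α∈D) (<-wellFounded _) var)
  where
  α∈D : α ∈ D
  α∈D = last∈ D ends

OuterBoxesIn : Formula → Formula → Set
OuterBoxesIn α φ = ∀ {γ} → (□ γ) ≼ φ → ¬ InScopeOf□ (□ γ) φ → (□ γ) ≼ α

boxFree⇒outerBoxesIn : ∀ {α φ} → BoxFree φ → OuterBoxesIn α φ
boxFree⇒outerBoxesIn free □γ≼φ _ = ⊥-elim (boxFree⇒□⋠ free □γ≼φ)

module Collapse (α : Formula) where

  collapse : Formula → Formula
  collapse (var n)  = var n
  collapse (a ∧' b) = collapse a ∧' collapse b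
  collapse (a ∨' b) = collapse a ∨' collapse b
  collapse (a ⇒ b)  = collapse a ⇒ collapse b
  collapse (¬' a)   = ¬' collapse a
  collapse (□ γ) with (□ γ) ≼? α
  ... | yes _ = □ γ
  ... | no  _ = p₀

  collapse-outerBoxesIn : ∀ φ → OuterBoxesIn α (collapse φ)
  collapse-outerBoxesIn (a ∧' b) (∧l p) out = collapse-outerBoxesIn a p (out ∘ InScopeOf□-≼ (∧l here))
  collapse-outerBoxesIn (a ∧' b) (∧r p) out = collapse-outerBoxesIn b p (out ∘ InScopeOf□-≼ (∧r here))
  collapse-outerBoxesIn (a ∨' b) (∨l p) out = collapse-outerBoxesIn a p (out ∘ InScopeOf□-≼ (∨l here))
  collapse-outerBoxesIn (a ∨' b) (∨r p) out = collapse-outerBoxesIn b p (out ∘ InScopeOf□-≼ (∨r here))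
  collapse-outerBoxesIn (a ⇒ b)  (⇒l p) out = collapse-outerBoxesIn a p (out ∘ InScopeOf□-≼ (⇒l here))
  collapse-outerBoxesIn (a ⇒ b)  (⇒r p) out = collapse-outerBoxesIn b p (out ∘ InScopeOf□-≼ (⇒r here))
  collapse-outerBoxesIn (¬' a)   (¬s p) out = collapse-outerBoxesIn a p (out ∘ InScopeOf□-≼ (¬s here))
  collapse-outerBoxesIn (□ δ) p out with (□ δ) ≼? α
  collapse-outerBoxesIn (□ δ) here   out | yes □δ≼α = □δ≼α
  collapse-outerBoxesIn (□ δ) (□s p) out | yes _    = ⊥-elim (out (δ , here , p))

  collapse-⟦⟧ : ∀ φ σ → BoxFree φ → collapse (φ ⟦ σ ⟧) ≡ φ ⟦ collapse ∘ σ ⟧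
  collapse-⟦⟧ (var n)  σ _         = refl
  collapse-⟦⟧ (a ∧' b) σ (fa , fb) = cong₂ _∧'_ (collapse-⟦⟧ a σ fa) (collapse-⟦⟧ b σ fb)
  collapse-⟦⟧ (a ∨' b) σ (fa , fb) = cong₂ _∨'_ (collapse-⟦⟧ a σ fa) (collapse-⟦⟧ b σ fb)
  collapse-⟦⟧ (a ⇒ b)  σ (fa , fb) = cong₂ _⇒_ (collapse-⟦⟧ a σ fa) (collapse-⟦⟧ b σ fb)
  collapse-⟦⟧ (¬' a)   σ fa        = cong ¬'_ (collapse-⟦⟧ a σ fa)

  collapse-fixed : ∀ φ → (∀ {γ} → (□ γ) ≼ φ → (□ γ) ≼ α) → collapse φ ≡ φ
  collapse-fixed (var n)  _    = refl
  collapse-fixed (a ∧' b) □≼α = cong₂ _∧'_ (collapse-fixed a (□≼α ∘ ∧l)) (collapse-fixed b (□≼α ∘ ∧r))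
  collapse-fixed (a ∨' b) □≼α = cong₂ _∨'_ (collapse-fixed a (□≼α ∘ ∨l)) (collapse-fixed b (□≼α ∘ ∨r))
  collapse-fixed (a ⇒ b)  □≼α = cong₂ _⇒_ (collapse-fixed a (□≼α ∘ ⇒l)) (collapse-fixed b (□≼α ∘ ⇒r))
  collapse-fixed (¬' a)   □≼α = cong ¬'_ (collapse-fixed a (□≼α ∘ ¬s))
  collapse-fixed (□ γ)    □≼α with (□ γ) ≼? α
  ... | yes _     = refl
  ... | no  □γ⋠α = ⊥-elim (□γ⋠α (□≼α here))

  collapse-tree : ∀ {P φ} → Tree P φ → Tree (OuterBoxesIn α) (collapse φ)
  collapse-tree (inst {φ} m _ σ _) =
    ≡.subst (Tree _) (sym commutes)
      (inst m (boxFree⇒outerBoxesIn free) (collapse ∘ σ)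
              (≡.subst (OuterBoxesIn α) commutes (collapse-outerBoxesIn (φ ⟦ σ ⟧))))
    where
    free : BoxFree φ
    free = All.lookup Ax₀-boxFree m
    commutes : collapse (φ ⟦ σ ⟧) ≡ φ ⟦ collapse ∘ σ ⟧
    commutes = collapse-⟦⟧ φ σ free
  collapse-tree (mp {b = b} d e _) = mp (collapse-tree d) (collapse-tree e) (collapse-outerBoxesIn b)

Refined : List Formula → Set
Refined D = (i : Fin (length D)) → Step AxiomSource D i

module _ {D E : List Formula} (f : Fin (length D) → Fin (length E))
         (lookup-f : ∀ i → lookup E (f i) ≡ lookup D i)
         (f-mono : ∀ {i j} → i Fin.< j → f i Fin.< f j) where

  Step-reindex : ∀ {S i} → Step S D i → Step S E (f i)
  Step-reindex {S} {i} (axiom m) = axiom (≡.subst (_∈ Ax₀) (sym (lookup-f i)) m)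
  Step-reindex {S} {i} (subst j j<i s σ eq) =
    subst (f j) (f-mono j<i) (≡.subst S (sym (lookup-f j)) s) σ
          (trans (lookup-f i) (trans eq (cong (_⟦ σ ⟧) (sym (lookup-f j)))))
  Step-reindex {S} {i} (mp j k j<i k<i eq) =
    mp (f j) (f k) (f-mono j<i) (f-mono k<i)
       (trans (lookup-f k) (trans eq (cong₂ _⇒_ (sym (lookup-f j)) (sym (lookup-f i)))))

module _ {x : Formula} where

  inject : ∀ D → Fin (length D) → Fin (length (D ∷ʳ x))
  inject (_ ∷ D) zero    = zero
  inject (_ ∷ D) (suc i) = suc (inject D i)

  top : ∀ D → Fin (length (D ∷ʳ x))
  top []      = zero
  top (_ ∷ D) = suc (top D)

  lookup-inject : ∀ D i → lookup (D ∷ʳ x) (inject D i) ≡ lookup D i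
  lookup-inject (_ ∷ D) zero    = refl
  lookup-inject (_ ∷ D) (suc i) = lookup-inject D i

  lookup-top : ∀ D → lookup (D ∷ʳ x) (top D) ≡ x
  lookup-top []      = refl
  lookup-top (_ ∷ D) = lookup-top D

  toℕ-inject : ∀ D i → toℕ (inject D i) ≡ toℕ i
  toℕ-inject (_ ∷ D) zero    = refl
  toℕ-inject (_ ∷ D) (suc i) = cong ℕ.suc (toℕ-inject D i)

  toℕ-top : ∀ D → toℕ (top D) ≡ length D
  toℕ-top []      = refl
  toℕ-top (_ ∷ D) = cong ℕ.suc (toℕ-top D)

  inject-mono : ∀ D {i j} → i Fin.< j → inject D i Fin.< inject D j
  inject-mono D {i} {j} rewrite toℕ-inject D i | toℕ-inject D j = id

  inject<top : ∀ D i → inject D i Fin.< top D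
  inject<top D i rewrite toℕ-inject D i | toℕ-top D = toℕ<n i

  data SnocIndex (D : List Formula) : Fin (length (D ∷ʳ x)) → Set where
    old : (i : Fin (length D)) → SnocIndex D (inject D i)
    new : SnocIndex D (top D)

  snocIndex : ∀ D i → SnocIndex D i
  snocIndex []      zero    = new
  snocIndex (_ ∷ D) zero    = old zero
  snocIndex (_ ∷ D) (suc i) with snocIndex D i
  ... | old j = old (suc j)
  ... | new   = new

  ∈⇒earlier-line : ∀ {D φ} → φ ∈ D → ∃[ j ] j Fin.< top D × lookup (D ∷ʳ x) j ≡ φ
  ∈⇒earlier-line {D} φ∈D =
    inject D i , inject<top D i , trans (lookup-inject D i) (sym (lookup-index φ∈D))
    where i = Any.index φ∈D

data Justified (D : List Formula) : Formula → Set where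
  axiom : ∀ {x} → x ∈ Ax₀ → Justified D x
  subst : ∀ {φ} → φ ∈ D → φ ∈ Ax₀ → (σ : Subst) → Justified D (φ ⟦ σ ⟧)
  mp    : ∀ {a b} → a ∈ D → (a ⇒ b) ∈ D → Justified D b

Justified⇒Step : ∀ {D x} → Justified D x → Step AxiomSource (D ∷ʳ x) (top D)
Justified⇒Step {D} (axiom m) = axiom (≡.subst (_∈ Ax₀) (sym (lookup-top D)) m)
Justified⇒Step {D} (subst φ∈D m σ) with ∈⇒earlier-line φ∈D
... | j , j<top , j↦φ =
  subst j j<top (≡.subst (_∈ Ax₀) (sym j↦φ) m) σ
        (trans (lookup-top D) (cong (_⟦ σ ⟧) (sym j↦φ)))
Justified⇒Step {D} {b} (mp a∈D a⇒b∈D) with ∈⇒earlier-line {b} a∈D | ∈⇒earlier-line {b} a⇒b∈D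
... | j , j<top , refl | k , k<top , eq =
  mp j k j<top k<top (trans eq (cong (lookup (D ∷ʳ b) j ⇒_) (sym (lookup-top D))))

∷ʳ-refined : ∀ {D x} → Refined D → Justified D x → Refined (D ∷ʳ x)
∷ʳ-refined {D} R J i with snocIndex D i
... | old j = Step-reindex (inject D) (lookup-inject D) (inject-mono D) (R j)
... | new   = Justified⇒Step J

last-∷ʳ : ∀ (D : List Formula) x → last (D ∷ʳ x) ≡ just x
last-∷ʳ []          x = refl
last-∷ʳ (_ ∷ [])    x = refl
last-∷ʳ (_ ∷ _ ∷ D) x = last-∷ʳ (_ ∷ D) x

record Extension (P : Formula → Set) (D : List Formula) (φ : Formula) : Set where
  field
    lines   : List Formula
    refined : Refined lines
    all-P   : All P lines
    extends : D ⊆ lines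
    ends    : last lines ≡ just φ

  ends∈ : φ ∈ lines
  ends∈ = last∈ lines ends

open Extension

module _ {P : Formula → Set} where

  snoc : ∀ {D x} → Refined D → All P D → Justified D x → P x → Extension P D x
  snoc {D} {x} R A J p = record
    { lines = D ∷ʳ x ; refined = ∷ʳ-refined R J ; all-P = ∷ʳ⁺ A p
    ; extends = xs⊆xs++ys D (x ∷ []) ; ends = last-∷ʳ D x }

  _▹_ : ∀ {D φ ψ} (E : Extension P D φ) → Extension P (lines E) ψ → Extension P D ψ
  E ▹ F = record
    { lines = lines F ; refined = refined F ; all-P = all-P F
    ; extends = ⊆-trans (extends E) (extends F) ; ends = ends F }

  flatten : ∀ {D φ} → Tree P φ → Refined D → All P D → Extension P D φ
  flatten {D} (inst {φ} m pφ σ pσ) R A =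
    E ▹ snoc (refined E) (all-P E) (subst (ends∈ E) m σ) pσ
    where
    E : Extension P D φ
    E = snoc R A (axiom m) pφ
  flatten {D} (mp {a} {b} d e pb) R A =
    E₁ ▹ (E₂ ▹ snoc (refined E₂) (all-P E₂) (mp (extends E₂ (ends∈ E₁)) (ends∈ E₂)) pb)
    where
    E₁ : Extension P D a
    E₁ = flatten d R A
    E₂ : Extension P (lines E₁) (a ⇒ b)
    E₂ = flatten e (refined E₁) (all-P E₁)

-- α is itself a line of D, so maximality in D already puts □γ outside the
-- scope of □ in α.
⊆M-[α] : ∀ {α D} → α ∈ D → All (OuterBoxesIn α) D → D ⊆M (α ∷ [])
⊆M-[α] α∈D outer _ ((γ , refl) , (φ , φ∈D , □γ≼φ) , maximal) =
  (γ , refl) ,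
  (_ , here refl , All.lookup outer φ∈D □γ≼φ (maximal φ φ∈D □γ≼φ)) ,
  λ { _ (here refl) → maximal _ α∈D }

corollary2p5 : (α : Formula) → Int□⊢ α → Int□⊩ α
corollary2p5 α (_ , derivation) =
  lines E , (refined E , ends E) , ⊆M-[α] (ends∈ E) (all-P E)
  where
  open Collapse α
  tree : Tree (OuterBoxesIn α) α
  tree = ≡.subst (Tree _) (collapse-fixed α id) (collapse-tree (derivation⇒tree derivation))
  E : Extension (OuterBoxesIn α) [] α
  E = flatten tree (λ ()) []
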